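{- Let an FSFL instance be given (clients $C$, facilities $F$, metric $\mathtt{dist}$, costs $c_f \ge 0$, revenues $r_j \ge 0$, subsidy $\delta > 0$), and let $(x, y)$ be a fractional solution with losses $\ell$ satisfying: $\sum_{f \in F} x_{j,f} = 1$ for all $j$; $0 \le x_{j,f} \le y_f \le 1$; $\ell_f \ge c_f y_f - \sum_{j} x_{j,f} r_j$ and $\ell_f \ge 0$ for all $f$; and $\sum_f \ell_f \le \delta \sum_j r_j$. Let $d_j = \sum_f x_{j,f} \mathtt{dist}(j,f)$. Let $(\overline{x}, \overline{y})$ be the output of $\alpha$-PointRounding applied to $(x,y)$, and let $\overline{\ell}_f = \max\bigl(0, c_f \overline{y}_f - \sum_j r_j \overline{x}_{j,f}\bigr)$. Then: 1. For every client $j$ and facility $f$, $\overline{x}_{j,f} > 0$ implies $\mathtt{dist}(j,f) \le 4 \max\left(1, \frac{1}{\delta}\right) d_j$. 2. $\sum_{f \in F} \overline{\ell}_f \le 2\delta \sum_{j \in C} r_j$.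
   Context: Algorithm $\alpha$-PointRounding$(x,y)$: set $\alpha = \frac{\delta+2}{2(\delta+1)}$. For each client $j$, order the facilities as $\pi(1), \pi(2), \ldots$ so that $\mathtt{dist}(j,\pi(1)) \le \mathtt{dist}(j,\pi(2)) \le \cdots$, let $z_{j,k} = \sum_{i \le k} x_{j,\pi(i)}$, let $k_j$ be the smallest index with $z_{j,k_j} \ge \alpha$, and set $\overline{x}_{j,\pi(i)} = x_{j,\pi(i)}/z_{j,k_j}$ for $i \le k_j$ and $\overline{x}_{j,\pi(i)} = 0$ for $i > k_j$. For each facility $f$, set $\overline{y}_f = y_f/\alpha$. Output $(\overline{x}, \overline{y})$.
   Formalization: The distances, costs $c_f$, revenues $r_j$, subsidy $\delta$ and the fractional solution $(x, y)$ with losses $\ell$ take values in ℚ rather than in the reals. -}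

module Defs where

open import Data.Nat as ℕ using (ℕ; zero; suc; _≤ᵇ_)
open import Data.Fin as Fin using (Fin; toℕ)
open import Data.Sum using (_⊎_; inj₁; inj₂)
open import Data.Product using (_×_)
open import Data.Bool using (if_then_else_)
open import Data.Rational using (ℚ; 0ℚ; 1ℚ; _+_; _*_; _-_; _÷_; _≤_; _<_; _⊔_; ≢-nonZero; _≟_)
open import Data.Fin.Permutation using (Permutation′; _⟨$⟩ʳ_; _⟨$⟩ˡ_)
open import Relation.Nullary using (yes; no)
open import Relation.Binary.PropositionalEquality using (_≡_)

Σℚ : ∀ {n} → (Fin n → ℚ) → ℚ
Σℚ {zero}  g = 0ℚ
Σℚ {suc n} g = g Fin.zero + Σℚ (λ i → g (Fin.suc i))

-- Total division: p / q, with the (never used here) convention p / 0 = 0.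
_/′_ : ℚ → ℚ → ℚ
p /′ q with q ≟ 0ℚ
... | yes _  = 0ℚ
... | no q≢0 = _÷_ p q {{≢-nonZero q≢0}}

2ℚ : ℚ
2ℚ = 1ℚ + 1ℚ

4ℚ : ℚ
4ℚ = 2ℚ + 2ℚ

-- Metric on the point set C ⊎ F (clients Fin m, facilities Fin n).
Point : ℕ → ℕ → Set
Point m n = Fin m ⊎ Fin n

record IsMetric {m n : ℕ} (d : Point m n → Point m n → ℚ) : Set where
  field
    nonneg : ∀ p q → 0ℚ ≤ d p q
    refl0  : ∀ p → d p p ≡ 0ℚ
    sym    : ∀ p q → d p q ≡ d q p
    tri    : ∀ p q s → d p s ≤ d p q + d q s

alpha : ℚ → ℚ
alpha δ = (δ + 2ℚ) /′ (2ℚ * (δ + 1ℚ))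

module PointRounding {m n : ℕ}
  (dist : Point m n → Point m n → ℚ)
  (x : Fin m → Fin n → ℚ) (y : Fin n → ℚ) (δ : ℚ)
  (π : Fin m → Permutation′ n) where

  dCF : Fin m → Fin n → ℚ
  dCF j f = dist (inj₁ j) (inj₂ f)

  -- π_j sorts the facilities by distance from j (positions are 0-based here)
  Sorted : Set
  Sorted = ∀ j (a b : Fin n) → a Fin.≤ b → dCF j (π j ⟨$⟩ʳ a) ≤ dCF j (π j ⟨$⟩ʳ b)

  z : Fin m → Fin n → ℚ
  z j k = Σℚ (λ i → if toℕ i ≤ᵇ toℕ k then x j (π j ⟨$⟩ʳ i) else 0ℚ)

  IsFirstReach : (Fin m → Fin n) → Set
  IsFirstReach k = ∀ j → (alpha δ ≤ z j (k j)) × (∀ i → i Fin.< k j → z j i < alpha δ)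

  module Output (k : Fin m → Fin n) where
    xbar : Fin m → Fin n → ℚ
    xbar j f = if toℕ (π j ⟨$⟩ˡ f) ≤ᵇ toℕ (k j) then x j f /′ z j (k j) else 0ℚ

    ybar : Fin n → ℚ
    ybar f = y f /′ alpha δ

    ℓbar : (c : Fin n → ℚ) (r : Fin m → ℚ) → Fin n → ℚ
    ℓbar c r f = 0ℚ ⊔ (c f * ybar f - Σℚ (λ j → r j * xbar j f))

-- Rescaling x_j by 1 / z_{j,k_j} ≤ 1 / α and y by 1 / α costs at most a factor 1 / α in every
-- facility's balance: ℓbar_f + Σ_j r_j xbar_{j,f} ≤ (ℓ_f + Σ_j r_j x_{j,f}) / α. Summing over f,
-- both revenue sums equal Σ r because the rows of x and of xbar sum to 1, and (δ + 1) / α ≤ 2δ + 1.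
-- For distances: a facility kept by j is no farther than ρ_j = dist(j, π_j(k_j)), while less than
-- α of j's mass lies strictly before position k_j, so at least 1 − α = δ / (2(δ + 1)) of it lies at
-- distance ≥ ρ_j. Hence ρ_j ≤ d_j / (1 − α) ≤ 4 max(1, 1/δ) d_j.
module Submission where

open import Defs
open import Data.Nat using (ℕ)
open import Data.Fin using (Fin)
open import Data.Sum using (inj₁; inj₂)
open import Data.Product using (_×_)
open import Data.Rational using (ℚ; 0ℚ; 1ℚ; _+_; _*_; _-_; _≤_; _<_; _⊔_)
open import Data.Fin.Permutation using (Permutation′)
open import Relation.Binary.PropositionalEquality using (_≡_)

open import Algebra.Bundles using (Ring; CommutativeMonoid)
import Algebra.Properties.Semiring.Sum as SemiringSum
open import Data.Bool using (Bool; true; false; if_then_else_; T)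
open import Data.Empty using (⊥-elim)
open import Data.Fin as Fin using (zero; suc; toℕ; inject₁)
import Data.Fin.Properties as Finₚ
open import Data.Fin.Permutation using (_⟨$⟩ʳ_; _⟨$⟩ˡ_; inverseʳ; inverseˡ)
import Data.Nat as ℕ
import Data.Nat.Properties as ℕₚ
open import Data.Product using (_,_; proj₁; proj₂)
open import Data.Rational using (-_; 1/_; ≢-nonZero; positive; nonNegative; _≟_)
open import Data.Rational.Properties
open import Algebra.Properties.CommutativeSemigroup
  (CommutativeMonoid.commutativeSemigroup *-1-commutativeMonoid) using (x∙yz≈z∙xy)
open import Data.Rational.Solver using (module +-*-Solver)
open import Relation.Nullary using (yes; no)
open import Relation.Binary.PropositionalEquality
  using (_≢_; ≢-sym; refl; sym; trans; cong; cong₂; subst; subst₂; module ≡-Reasoning)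

+-nonNeg : ∀ {p q} → 0ℚ ≤ p → 0ℚ ≤ q → 0ℚ ≤ p + q
+-nonNeg = +-mono-≤

*-nonNeg : ∀ {p q} → 0ℚ ≤ p → 0ℚ ≤ q → 0ℚ ≤ p * q
*-nonNeg {p} {q} 0≤p 0≤q =
  subst (_≤ p * q) (*-zeroʳ p) (*-monoˡ-≤-nonNeg p {{nonNegative 0≤p}} 0≤q)

*-pos : ∀ {p q} → 0ℚ < p → 0ℚ < q → 0ℚ < p * q
*-pos {p} {q} 0<p 0<q =
  positive⁻¹ (p * q) {{pos*pos⇒pos p {{positive 0<p}} q {{positive 0<q}}}}

0<p⇒p≢0 : ∀ {p} → 0ℚ < p → p ≢ 0ℚ
0<p⇒p≢0 0<p = ≢-sym (<⇒≢ 0<p)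

p≤p+q : ∀ {p q} → 0ℚ ≤ q → p ≤ p + q
p≤p+q {p} {q} 0≤q = subst (_≤ p + q) (+-identityʳ p) (+-monoʳ-≤ p 0≤q)

p-q+q≡p : ∀ p q → p - q + q ≡ p
p-q+q≡p p q = begin
  p - q + q      ≡⟨ +-assoc p (- q) q ⟩
  p + (- q + q)  ≡⟨ cong (p +_) (+-inverseˡ q) ⟩
  p + 0ℚ         ≡⟨ +-identityʳ p ⟩
  p              ∎
  where open ≡-Reasoning

p+q-q≡p : ∀ p q → p + q - q ≡ p
p+q-q≡p p q = begin
  p + q - q      ≡⟨ +-assoc p q (- q) ⟩
  p + (q - q)    ≡⟨ cong (p +_) (+-inverseʳ q) ⟩
  p + 0ℚ         ≡⟨ +-identityʳ p ⟩
  p              ∎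
  where open ≡-Reasoning

+-cancelʳ-≤ : ∀ {p q} r → p + r ≤ q + r → p ≤ q
+-cancelʳ-≤ {p} {q} r p+r≤q+r =
  subst₂ _≤_ (p+q-q≡p p r) (p+q-q≡p q r) (+-monoˡ-≤ (- r) p+r≤q+r)

0⊔[p-q]+q≤r : ∀ {p q r} → q ≤ r → p ≤ r → 0ℚ ⊔ (p - q) + q ≤ r
0⊔[p-q]+q≤r {p} {q} {r} q≤r p≤r = begin
  0ℚ ⊔ (p - q) + q        ≡⟨ mono-≤-distrib-⊔ (+-monoˡ-≤ q) 0ℚ (p - q) ⟩
  (0ℚ + q) ⊔ (p - q + q)  ≡⟨ cong₂ _⊔_ (+-identityˡ q) (p-q+q≡p p q) ⟩
  q ⊔ p                   ≤⟨ ⊔-lub q≤r p≤r ⟩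
  r                       ∎
  where open ≤-Reasoning

p/′q≡p*1/′q : ∀ p q → p /′ q ≡ p * (1ℚ /′ q)
p/′q≡p*1/′q p q with q ≟ 0ℚ
... | yes _ = sym (*-zeroʳ p)
... | no  _ = cong (p *_) (sym (*-identityˡ _))

/′-inverseʳ : ∀ {p} → p ≢ 0ℚ → p * (1ℚ /′ p) ≡ 1ℚ
/′-inverseʳ {p} p≢0 with p ≟ 0ℚ
... | yes p≡0 = ⊥-elim (p≢0 p≡0)
... | no  p≢0 = trans (cong (p *_) (*-identityˡ _)) (*-inverseʳ p {{≢-nonZero p≢0}})

1/′-pos : ∀ {p} → 0ℚ < p → 0ℚ < 1ℚ /′ p
1/′-pos {p} 0<p with p ≟ 0ℚ
... | yes p≡0 = ⊥-elim (0<p⇒p≢0 0<p p≡0)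
... | no  p≢0 = subst (0ℚ <_) (sym (*-identityˡ 1/p))
                  (positive⁻¹ 1/p {{1/pos⇒pos p {{positive 0<p}}}})
  where
  1/p : ℚ
  1/p = (1/ p) {{≢-nonZero p≢0}}

/′-*-cancel : ∀ p {q} → q ≢ 0ℚ → (p /′ q) * q ≡ p
/′-*-cancel p {q} q≢0 = begin
  (p /′ q) * q         ≡⟨ cong (_* q) (p/′q≡p*1/′q p q) ⟩
  p * (1ℚ /′ q) * q    ≡⟨ *-assoc p (1ℚ /′ q) q ⟩
  p * ((1ℚ /′ q) * q)  ≡⟨ cong (p *_) (trans (*-comm (1ℚ /′ q) q) (/′-inverseʳ q≢0)) ⟩
  p * 1ℚ               ≡⟨ *-identityʳ p ⟩
  p                    ∎
  where open ≡-Reasoning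

1/′-antimono-≤ : ∀ {p q} → 0ℚ < p → p ≤ q → 1ℚ /′ q ≤ 1ℚ /′ p
1/′-antimono-≤ {p} {q} 0<p p≤q = begin
  1/q              ≡⟨ *-identityʳ 1/q ⟨
  1/q * 1ℚ         ≡⟨ cong (1/q *_) (/′-inverseʳ (0<p⇒p≢0 0<p)) ⟨
  1/q * (p * 1/p)  ≤⟨ *-monoˡ-≤-nonNeg 1/q {{nonNegative (<⇒≤ (1/′-pos 0<q))}}
                        (*-monoʳ-≤-nonNeg 1/p {{nonNegative (<⇒≤ (1/′-pos 0<p))}} p≤q) ⟩
  1/q * (q * 1/p)  ≡⟨ *-assoc 1/q q 1/p ⟨
  1/q * q * 1/p    ≡⟨ cong (_* 1/p) (trans (*-comm 1/q q) (/′-inverseʳ (0<p⇒p≢0 0<q))) ⟩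
  1ℚ * 1/p         ≡⟨ *-identityˡ 1/p ⟩
  1/p              ∎
  where
  open ≤-Reasoning
  1/p 1/q : ℚ
  1/p = 1ℚ /′ p
  1/q = 1ℚ /′ q
  0<q : 0ℚ < q
  0<q = <-≤-trans 0<p p≤q

module _ {δ : ℚ} (0≤δ : 0ℚ ≤ δ) where

  0<2[δ+1] : 0ℚ < 2ℚ * (δ + 1ℚ)
  0<2[δ+1] = *-pos (positive⁻¹ 2ℚ) (+-mono-≤-< 0≤δ (positive⁻¹ 1ℚ))

  private
    0<δ+2 : 0ℚ < δ + 2ℚ
    0<δ+2 = +-mono-≤-< 0≤δ (positive⁻¹ 2ℚ)

  alpha-pos : 0ℚ < alpha δ
  alpha-pos = subst (0ℚ <_) (sym (p/′q≡p*1/′q (δ + 2ℚ) (2ℚ * (δ + 1ℚ))))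
    (*-pos 0<δ+2 (1/′-pos 0<2[δ+1]))

  alpha*2[δ+1]≡δ+2 : alpha δ * (2ℚ * (δ + 1ℚ)) ≡ δ + 2ℚ
  alpha*2[δ+1]≡δ+2 = /′-*-cancel (δ + 2ℚ) (0<p⇒p≢0 0<2[δ+1])

  [1-alpha]*2[δ+1]≡δ : (1ℚ - alpha δ) * (2ℚ * (δ + 1ℚ)) ≡ δ
  [1-alpha]*2[δ+1]≡δ = begin
    (1ℚ - alpha δ) * 2[δ+1]     ≡⟨ distrib (alpha δ) 2[δ+1] ⟩
    2[δ+1] - alpha δ * 2[δ+1]   ≡⟨ cong (λ t → 2[δ+1] - t) alpha*2[δ+1]≡δ+2 ⟩
    2[δ+1] - (δ + 2ℚ)           ≡⟨ simplify δ ⟩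
    δ                           ∎
    where
    open ≡-Reasoning
    open +-*-Solver
    2[δ+1] : ℚ
    2[δ+1] = 2ℚ * (δ + 1ℚ)
    distrib : ∀ a b → (1ℚ - a) * b ≡ b - a * b
    distrib = solve 2 (λ a b → (con 1ℚ :- a) :* b := b :- a :* b) refl
    simplify : ∀ δ → 2ℚ * (δ + 1ℚ) - (δ + 2ℚ) ≡ δ
    simplify = solve 1 (λ δ → con 2ℚ :* (δ :+ con 1ℚ) :- (δ :+ con 2ℚ) := δ) refl

  1/′alpha*[δ+1]≤2δ+1 : (1ℚ /′ alpha δ) * (δ + 1ℚ) ≤ 2ℚ * δ + 1ℚ
  1/′alpha*[δ+1]≤2δ+1 = *-cancelʳ-≤-pos (δ + 2ℚ) {{positive 0<δ+2}} (begin
    1/α * (δ + 1ℚ) * (δ + 2ℚ)              ≡⟨ cong (1/α * (δ + 1ℚ) *_) alpha*2[δ+1]≡δ+2 ⟨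
    1/α * (δ + 1ℚ) * (alpha δ * 2[δ+1])    ≡⟨ regroup 1/α (δ + 1ℚ) (alpha δ) 2[δ+1] ⟩
    (alpha δ * 1/α) * ((δ + 1ℚ) * 2[δ+1])
      ≡⟨ cong (_* ((δ + 1ℚ) * 2[δ+1])) (/′-inverseʳ (0<p⇒p≢0 alpha-pos)) ⟩
    1ℚ * ((δ + 1ℚ) * 2[δ+1])               ≡⟨ *-identityˡ ((δ + 1ℚ) * 2[δ+1]) ⟩
    (δ + 1ℚ) * 2[δ+1]                      ≤⟨ p≤p+q 0≤δ ⟩
    (δ + 1ℚ) * 2[δ+1] + δ                  ≡⟨ expand δ ⟩
    (2ℚ * δ + 1ℚ) * (δ + 2ℚ)               ∎)
    where
    open ≤-Reasoning
    open +-*-Solver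
    1/α 2[δ+1] : ℚ
    1/α = 1ℚ /′ alpha δ
    2[δ+1] = 2ℚ * (δ + 1ℚ)
    regroup : ∀ a b c d → a * b * (c * d) ≡ (c * a) * (b * d)
    regroup = solve 4 (λ a b c d → a :* b :* (c :* d) := (c :* a) :* (b :* d)) refl
    expand : ∀ δ → (δ + 1ℚ) * (2ℚ * (δ + 1ℚ)) + δ ≡ (2ℚ * δ + 1ℚ) * (δ + 2ℚ)
    expand = solve 1 (λ δ → (δ :+ con 1ℚ) :* (con 2ℚ :* (δ :+ con 1ℚ)) :+ δ
                          := (con 2ℚ :* δ :+ con 1ℚ) :* (δ :+ con 2ℚ)) refl

2[δ+1]≤4[1⊔1/′δ]*δ : ∀ {δ} → 0ℚ < δ → 2ℚ * (δ + 1ℚ) ≤ 4ℚ * (1ℚ ⊔ (1ℚ /′ δ)) * δ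
2[δ+1]≤4[1⊔1/′δ]*δ {δ} 0<δ = begin
  2ℚ * (δ + 1ℚ)         ≤⟨ *-monoˡ-≤-nonNeg 2ℚ (+-mono-≤ δ≤M*δ 1≤M*δ) ⟩
  2ℚ * (M * δ + M * δ)  ≡⟨ double M δ ⟩
  4ℚ * M * δ            ∎
  where
  open ≤-Reasoning
  open +-*-Solver
  M : ℚ
  M = 1ℚ ⊔ (1ℚ /′ δ)
  0≤δ : 0ℚ ≤ δ
  0≤δ = <⇒≤ 0<δ
  δ≤M*δ : δ ≤ M * δ
  δ≤M*δ = subst (_≤ M * δ) (*-identityˡ δ)
    (*-monoʳ-≤-nonNeg δ {{nonNegative 0≤δ}} (p≤p⊔q 1ℚ (1ℚ /′ δ)))
  1≤M*δ : 1ℚ ≤ M * δ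
  1≤M*δ = subst (_≤ M * δ) (trans (*-comm (1ℚ /′ δ) δ) (/′-inverseʳ (0<p⇒p≢0 0<δ)))
    (*-monoʳ-≤-nonNeg δ {{nonNegative 0≤δ}} (p≤q⊔p 1ℚ (1ℚ /′ δ)))
  double : ∀ M δ → 2ℚ * (M * δ + M * δ) ≡ 4ℚ * M * δ
  double = solve 2 (λ M δ → con 2ℚ :* (M :* δ :+ M :* δ) := con 4ℚ :* M :* δ) refl

1≤4[1⊔1/′δ]*[1-alpha] : ∀ {δ} → 0ℚ < δ →
                        1ℚ ≤ 4ℚ * (1ℚ ⊔ (1ℚ /′ δ)) * (1ℚ - alpha δ)
1≤4[1⊔1/′δ]*[1-alpha] {δ} 0<δ =
  *-cancelˡ-≤-pos 2[δ+1] {{positive (0<2[δ+1] (<⇒≤ 0<δ))}} (begin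
    2[δ+1] * 1ℚ                     ≡⟨ *-identityʳ 2[δ+1] ⟩
    2[δ+1]                          ≤⟨ 2[δ+1]≤4[1⊔1/′δ]*δ 0<δ ⟩
    4M * δ                          ≡⟨ cong (4M *_) ([1-alpha]*2[δ+1]≡δ (<⇒≤ 0<δ)) ⟨
    4M * ((1ℚ - alpha δ) * 2[δ+1])  ≡⟨ x∙yz≈z∙xy 4M (1ℚ - alpha δ) 2[δ+1] ⟩
    2[δ+1] * (4M * (1ℚ - alpha δ))  ∎)
  where
  open ≤-Reasoning
  2[δ+1] 4M : ℚ
  2[δ+1] = 2ℚ * (δ + 1ℚ)
  4M = 4ℚ * (1ℚ ⊔ (1ℚ /′ δ))

t≤s+alpha*t⇒t≤4[1⊔1/′δ]*s : ∀ {δ s t} → 0ℚ < δ → 0ℚ ≤ t → t ≤ s + alpha δ * t →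
                             t ≤ 4ℚ * (1ℚ ⊔ (1ℚ /′ δ)) * s
t≤s+alpha*t⇒t≤4[1⊔1/′δ]*s {δ} {s} {t} 0<δ 0≤t t≤s+αt = begin
  t                     ≡⟨ *-identityˡ t ⟨
  1ℚ * t                ≤⟨ *-monoʳ-≤-nonNeg t {{nonNegative 0≤t}} (1≤4[1⊔1/′δ]*[1-alpha] 0<δ) ⟩
  4M * (1ℚ - α) * t     ≡⟨ *-assoc 4M (1ℚ - α) t ⟩
  4M * ((1ℚ - α) * t)   ≤⟨ *-monoˡ-≤-nonNeg 4M {{nonNegative 0≤4M}} [1-α]*t≤s ⟩
  4M * s                ∎
  where
  open ≤-Reasoning
  open +-*-Solver
  α 4M : ℚ
  α = alpha δ
  4M = 4ℚ * (1ℚ ⊔ (1ℚ /′ δ))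
  0≤4M : 0ℚ ≤ 4M
  0≤4M = *-nonNeg (nonNegative⁻¹ 4ℚ) (≤-trans (nonNegative⁻¹ 1ℚ) (p≤p⊔q 1ℚ (1ℚ /′ δ)))
  split : ∀ a t → (1ℚ - a) * t + a * t ≡ t
  split = solve 2 (λ a t → (con 1ℚ :- a) :* t :+ a :* t := t) refl
  [1-α]*t≤s : (1ℚ - α) * t ≤ s
  [1-α]*t≤s = +-cancelʳ-≤ (α * t) (subst (_≤ s + α * t) (sym (split α t)) t≤s+αt)

module Σ = SemiringSum (Ring.semiring +-*-ring)

Σℚ≡sum : ∀ {n} (f : Fin n → ℚ) → Σℚ f ≡ Σ.sum f
Σℚ≡sum {ℕ.zero}  f = refl
Σℚ≡sum {ℕ.suc n} f = cong (f zero +_) (Σℚ≡sum (λ i → f (suc i)))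

Σℚ-cong : ∀ {n} {f g : Fin n → ℚ} → (∀ i → f i ≡ g i) → Σℚ f ≡ Σℚ g
Σℚ-cong {ℕ.zero}  f≗g = refl
Σℚ-cong {ℕ.suc n} f≗g = cong₂ _+_ (f≗g zero) (Σℚ-cong (λ i → f≗g (suc i)))

Σℚ-mono-≤ : ∀ {n} {f g : Fin n → ℚ} → (∀ i → f i ≤ g i) → Σℚ f ≤ Σℚ g
Σℚ-mono-≤ {ℕ.zero}  f≤g = ≤-refl
Σℚ-mono-≤ {ℕ.suc n} f≤g = +-mono-≤ (f≤g zero) (Σℚ-mono-≤ (λ i → f≤g (suc i)))

Σℚ-nonNeg : ∀ {n} {f : Fin n → ℚ} → (∀ i → 0ℚ ≤ f i) → 0ℚ ≤ Σℚ f
Σℚ-nonNeg {ℕ.zero}  0≤f = ≤-refl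
Σℚ-nonNeg {ℕ.suc n} 0≤f = +-nonNeg (0≤f zero) (Σℚ-nonNeg (λ i → 0≤f (suc i)))

Σℚ-zero : ∀ n → Σℚ {n} (λ _ → 0ℚ) ≡ 0ℚ
Σℚ-zero n = trans (Σℚ≡sum {n} (λ _ → 0ℚ)) (Σ.sum-replicate-zero n)

Σℚ-distrib-+ : ∀ {n} (f g : Fin n → ℚ) → Σℚ (λ i → f i + g i) ≡ Σℚ f + Σℚ g
Σℚ-distrib-+ f g = begin
  Σℚ (λ i → f i + g i)     ≡⟨ Σℚ≡sum (λ i → f i + g i) ⟩
  Σ.sum (λ i → f i + g i)  ≡⟨ Σ.∑-distrib-+ f g ⟩
  Σ.sum f + Σ.sum g        ≡⟨ cong₂ _+_ (Σℚ≡sum f) (Σℚ≡sum g) ⟨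
  Σℚ f + Σℚ g              ∎
  where open ≡-Reasoning

*-distribˡ-Σℚ : ∀ {n} c (f : Fin n → ℚ) → c * Σℚ f ≡ Σℚ (λ i → c * f i)
*-distribˡ-Σℚ c f = begin
  c * Σℚ f               ≡⟨ cong (c *_) (Σℚ≡sum f) ⟩
  c * Σ.sum f            ≡⟨ Σ.*-distribˡ-sum c f ⟩
  Σ.sum (λ i → c * f i)  ≡⟨ Σℚ≡sum (λ i → c * f i) ⟨
  Σℚ (λ i → c * f i)     ∎
  where open ≡-Reasoning

*-distribʳ-Σℚ : ∀ {n} c (f : Fin n → ℚ) → Σℚ f * c ≡ Σℚ (λ i → f i * c)
*-distribʳ-Σℚ c f = begin
  Σℚ f * c               ≡⟨ cong (_* c) (Σℚ≡sum f) ⟩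
  Σ.sum f * c            ≡⟨ Σ.*-distribʳ-sum c f ⟩
  Σ.sum (λ i → f i * c)  ≡⟨ Σℚ≡sum (λ i → f i * c) ⟨
  Σℚ (λ i → f i * c)     ∎
  where open ≡-Reasoning

Σℚ-comm : ∀ {m n} (f : Fin m → Fin n → ℚ) →
          Σℚ (λ i → Σℚ (λ j → f i j)) ≡ Σℚ (λ j → Σℚ (λ i → f i j))
Σℚ-comm f = begin
  Σℚ (λ i → Σℚ (f i))                ≡⟨ Σℚ-cong (λ i → Σℚ≡sum (f i)) ⟩
  Σℚ (λ i → Σ.sum (f i))             ≡⟨ Σℚ≡sum (λ i → Σ.sum (f i)) ⟩
  Σ.sum (λ i → Σ.sum (f i))          ≡⟨ Σ.∑-comm f ⟩
  Σ.sum (λ j → Σ.sum (λ i → f i j))  ≡⟨ Σℚ≡sum (λ j → Σ.sum (λ i → f i j)) ⟨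
  Σℚ (λ j → Σ.sum (λ i → f i j))     ≡⟨ Σℚ-cong (λ j → Σℚ≡sum (λ i → f i j)) ⟨
  Σℚ (λ j → Σℚ (λ i → f i j))        ∎
  where open ≡-Reasoning

Σℚ-permute : ∀ {n} (f : Fin n → ℚ) (π : Permutation′ n) →
             Σℚ f ≡ Σℚ (λ i → f (π ⟨$⟩ʳ i))
Σℚ-permute f π = begin
  Σℚ f                        ≡⟨ Σℚ≡sum f ⟩
  Σ.sum f                     ≡⟨ Σ.sum-permute f π ⟩
  Σ.sum (λ i → f (π ⟨$⟩ʳ i))  ≡⟨ Σℚ≡sum (λ i → f (π ⟨$⟩ʳ i)) ⟨
  Σℚ (λ i → f (π ⟨$⟩ʳ i))     ∎
  where open ≡-Reasoning

Σℚ-Σℚ-weighted-rows : ∀ {m n} (r : Fin m → ℚ) (w : Fin m → Fin n → ℚ) →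
                      (∀ j → Σℚ (w j) ≡ 1ℚ) →
                      Σℚ (λ f → Σℚ (λ j → r j * w j f)) ≡ Σℚ r
Σℚ-Σℚ-weighted-rows r w Σw≡1 = begin
  Σℚ (λ f → Σℚ (λ j → r j * w j f))  ≡⟨ Σℚ-comm (λ j f → r j * w j f) ⟨
  Σℚ (λ j → Σℚ (λ f → r j * w j f))  ≡⟨ Σℚ-cong (λ j → *-distribˡ-Σℚ (r j) (w j)) ⟨
  Σℚ (λ j → r j * Σℚ (w j))          ≡⟨ Σℚ-cong (λ j → cong (r j *_) (Σw≡1 j)) ⟩
  Σℚ (λ j → r j * 1ℚ)                ≡⟨ Σℚ-cong (λ j → *-identityʳ (r j)) ⟩
  Σℚ r                               ∎
  where open ≡-Reasoning

mask : ∀ {n} → (Fin n → Bool) → (Fin n → ℚ) → Fin n → ℚ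
mask p w i = if p i then w i else 0ℚ

mask-pos⇒T : ∀ {n} (p : Fin n → Bool) (w : Fin n → ℚ) i → 0ℚ < mask p w i → T (p i)
mask-pos⇒T p w i with p i
... | true  = _
... | false = <-irrefl refl

mask-≤ : ∀ {n} (p : Fin n → Bool) {w : Fin n → ℚ} i → 0ℚ ≤ w i → mask p w i ≤ w i
mask-≤ p i 0≤wi with p i
... | true  = ≤-refl
... | false = 0≤wi

mask-/′ : ∀ {n} (p : Fin n → Bool) (w : Fin n → ℚ) q i →
          mask p (λ l → w l /′ q) i ≡ mask p w i * (1ℚ /′ q)
mask-/′ p w q i with p i
... | true  = p/′q≡p*1/′q (w i) q
... | false = sym (*-zeroˡ (1ℚ /′ q))

masked-tail-bound : ∀ {n} (w d : Fin n → ℚ) (p : Fin n → Bool) D →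
  (∀ i → 0ℚ ≤ w i) → (∀ i → 0ℚ ≤ d i) → (∀ i → p i ≡ false → D ≤ d i) →
  Σℚ w * D ≤ Σℚ (λ i → w i * d i) + Σℚ (mask p w) * D
masked-tail-bound {n} w d p D 0≤w 0≤d unmasked⇒D≤d = begin
  Σℚ w * D                                     ≡⟨ *-distribʳ-Σℚ D w ⟩
  Σℚ (λ i → w i * D)                           ≤⟨ Σℚ-mono-≤ term-bound ⟩
  Σℚ (λ i → w i * d i + mask p w i * D)        ≡⟨ Σℚ-distrib-+ wd (λ i → mask p w i * D) ⟩
  Σℚ wd + Σℚ (λ i → mask p w i * D)            ≡⟨ cong (Σℚ wd +_) (*-distribʳ-Σℚ D (mask p w)) ⟨
  Σℚ wd + Σℚ (mask p w) * D                    ∎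
  where
  open ≤-Reasoning
  wd : Fin n → ℚ
  wd i = w i * d i
  term-bound : ∀ i → w i * D ≤ w i * d i + mask p w i * D
  term-bound i with p i | unmasked⇒D≤d i
  ... | true  | _   = subst (w i * D ≤_) (+-comm (w i * D) (wd i)) (p≤p+q (*-nonNeg (0≤w i) (0≤d i)))
  ... | false | D≤d = begin
    w i * D             ≤⟨ *-monoˡ-≤-nonNeg (w i) {{nonNegative (0≤w i)}} (D≤d refl) ⟩
    w i * d i           ≡⟨ +-identityʳ (wd i) ⟨
    w i * d i + 0ℚ      ≡⟨ cong (wd i +_) (*-zeroˡ D) ⟨
    w i * d i + 0ℚ * D  ∎

-- before K i holds iff i < K. For K = suc K′ it is literally the predicate of the prefix sum z at
-- position inject₁ K′, so the first-reach hypothesis bounds its mass without any rewriting.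
before : ∀ {n} → Fin n → Fin n → Bool
before zero    _ = false
before (suc K) i = toℕ i ℕ.≤ᵇ toℕ (inject₁ K)

before≡false⇒≥ : ∀ {n} (K i : Fin n) → before K i ≡ false → K Fin.≤ i
before≡false⇒≥ zero    i _   = ℕ.z≤n
before≡false⇒≥ (suc K) i i≰K = subst (ℕ._< toℕ i) (Finₚ.toℕ-inject₁ K)
  (ℕₚ.≰⇒> (λ i≤K → subst T i≰K (ℕₚ.≤⇒≤ᵇ i≤K)))

Σmask-before≤ : ∀ {n} (w : Fin n → ℚ) {a} → 0ℚ ≤ a → (K : Fin n) →
  (∀ (i : Fin n) → i Fin.< K → Σℚ (mask (λ l → toℕ l ℕ.≤ᵇ toℕ i) w) < a) →
  Σℚ (mask (before K) w) ≤ a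
Σmask-before≤ {n} w 0≤a zero    _     = subst (_≤ _) (sym (Σℚ-zero n)) 0≤a
Σmask-before≤     w _   (suc K) below = <⇒≤ (below (inject₁ K) (Finₚ.≤̄⇒inject₁< ℕₚ.≤-refl))

-- xbar j is definitionally mask (selected j) (λ f → x j f /′ z j (k j)), and z j i is
-- Σℚ (mask (λ l → toℕ l ≤ᵇ toℕ i) (xπ j)).
module FirstReachRounding {m n : ℕ}
    (dist : Point m n → Point m n → ℚ) (x : Fin m → Fin n → ℚ) (y : Fin n → ℚ) {δ : ℚ}
    (π : Fin m → Permutation′ n) (k : Fin m → Fin n)
    (0≤δ : 0ℚ ≤ δ) (0≤x : ∀ j f → 0ℚ ≤ x j f) (Σx≡1 : ∀ j → Σℚ (x j) ≡ 1ℚ)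
    (first-reach : PointRounding.IsFirstReach dist x y δ π k) where

  open PointRounding dist x y δ π
  open Output k

  α : ℚ
  α = alpha δ

  0≤1/′α : 0ℚ ≤ 1ℚ /′ α
  0≤1/′α = <⇒≤ (1/′-pos (alpha-pos 0≤δ))

  selected : Fin m → Fin n → Bool
  selected j f = toℕ (π j ⟨$⟩ˡ f) ℕ.≤ᵇ toℕ (k j)

  xπ : Fin m → Fin n → ℚ
  xπ j i = x j (π j ⟨$⟩ʳ i)

  d : Fin m → ℚ
  d j = Σℚ (λ f → x j f * dCF j f)

  0<z : ∀ j → 0ℚ < z j (k j)
  0<z j = <-≤-trans (alpha-pos 0≤δ) (proj₁ (first-reach j))

  Σmask-selected≡z : ∀ j → Σℚ (mask (selected j) (x j)) ≡ z j (k j)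
  Σmask-selected≡z j = trans (Σℚ-permute (mask (selected j) (x j)) (π j))
    (Σℚ-cong (λ i → cong (λ l → if toℕ l ℕ.≤ᵇ toℕ (k j) then xπ j i else 0ℚ) (inverseˡ (π j))))

  Σxbar≡1 : ∀ j → Σℚ (xbar j) ≡ 1ℚ
  Σxbar≡1 j = begin
    Σℚ (xbar j)                  ≡⟨ Σℚ-cong (mask-/′ (selected j) (x j) (z j (k j))) ⟩
    Σℚ (λ f → xsel f * 1/z)      ≡⟨ *-distribʳ-Σℚ 1/z xsel ⟨
    Σℚ xsel * 1/z                ≡⟨ cong (_* 1/z) (Σmask-selected≡z j) ⟩
    z j (k j) * 1/z              ≡⟨ /′-inverseʳ (0<p⇒p≢0 (0<z j)) ⟩
    1ℚ                           ∎
    where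
    open ≡-Reasoning
    xsel : Fin n → ℚ
    xsel = mask (selected j) (x j)
    1/z : ℚ
    1/z = 1ℚ /′ z j (k j)

  xbar≤x*1/′α : ∀ j f → xbar j f ≤ x j f * (1ℚ /′ α)
  xbar≤x*1/′α j f = begin
    xbar j f                         ≡⟨ mask-/′ (selected j) (x j) (z j (k j)) f ⟩
    mask (selected j) (x j) f * 1/z  ≤⟨ *-monoʳ-≤-nonNeg 1/z {{nonNegative (<⇒≤ (1/′-pos (0<z j)))}}
                                          (mask-≤ (selected j) {x j} f (0≤x j f)) ⟩
    x j f * 1/z                      ≤⟨ *-monoˡ-≤-nonNeg (x j f) {{nonNegative (0≤x j f)}}
                                          (1/′-antimono-≤ (alpha-pos 0≤δ) (proj₁ (first-reach j))) ⟩
    x j f * (1ℚ /′ α)                ∎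
    where
    open ≤-Reasoning
    1/z : ℚ
    1/z = 1ℚ /′ z j (k j)

  xbar-pos⇒≤k : ∀ j f → 0ℚ < xbar j f → π j ⟨$⟩ˡ f Fin.≤ k j
  xbar-pos⇒≤k j f 0<xbar =
    ℕₚ.≤ᵇ⇒≤ _ _ (mask-pos⇒T (selected j) (λ f′ → x j f′ /′ z j (k j)) f 0<xbar)

  module _ (0≤dist : ∀ p q → 0ℚ ≤ dist p q) (sorted : Sorted) where

    radius : Fin m → ℚ
    radius j = dCF j (π j ⟨$⟩ʳ k j)

    xbar-pos⇒dist≤radius : ∀ j f → 0ℚ < xbar j f → dCF j f ≤ radius j
    xbar-pos⇒dist≤radius j f 0<xbar = subst (λ g → dCF j g ≤ radius j) (inverseʳ (π j))
      (sorted j (π j ⟨$⟩ˡ f) (k j) (xbar-pos⇒≤k j f 0<xbar))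

    radius≤d+α*radius : ∀ j → radius j ≤ d j + α * radius j
    radius≤d+α*radius j = begin
      ρ                                           ≡⟨ *-identityˡ ρ ⟨
      1ℚ * ρ                                      ≡⟨ cong (_* ρ) Σxπ≡1 ⟨
      Σℚ (xπ j) * ρ
        ≤⟨ masked-tail-bound (xπ j) dπ (before K) ρ (λ i → 0≤x j (π j ⟨$⟩ʳ i)) 0≤dπ
             (λ i i∉ → sorted j K i (before≡false⇒≥ K i i∉)) ⟩
      Σℚ xdπ + Σℚ (mask (before K) (xπ j)) * ρ
        ≤⟨ +-monoʳ-≤ (Σℚ xdπ) (*-monoʳ-≤-nonNeg ρ {{nonNegative (0≤dπ K)}} before-mass≤α) ⟩
      Σℚ xdπ + α * ρ                              ≡⟨ cong (_+ α * ρ) Σxd≡Σxdπ ⟨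
      d j + α * ρ                                 ∎
      where
      open ≤-Reasoning
      K : Fin n
      K = k j
      dπ xdπ : Fin n → ℚ
      dπ i = dCF j (π j ⟨$⟩ʳ i)
      xdπ i = xπ j i * dπ i
      ρ : ℚ
      ρ = dπ K
      0≤dπ : ∀ i → 0ℚ ≤ dπ i
      0≤dπ i = 0≤dist (inj₁ j) (inj₂ (π j ⟨$⟩ʳ i))
      Σxπ≡1 : Σℚ (xπ j) ≡ 1ℚ
      Σxπ≡1 = trans (sym (Σℚ-permute (x j) (π j))) (Σx≡1 j)
      Σxd≡Σxdπ : d j ≡ Σℚ xdπ
      Σxd≡Σxdπ = Σℚ-permute (λ f → x j f * dCF j f) (π j)
      before-mass≤α : Σℚ (mask (before K) (xπ j)) ≤ α
      before-mass≤α = Σmask-before≤ (xπ j) (<⇒≤ (alpha-pos 0≤δ)) K (proj₂ (first-reach j))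

    service-distance-bound : 0ℚ < δ →
      ∀ j f → 0ℚ < xbar j f → dCF j f ≤ 4ℚ * (1ℚ ⊔ (1ℚ /′ δ)) * d j
    service-distance-bound 0<δ j f 0<xbar = ≤-trans (xbar-pos⇒dist≤radius j f 0<xbar)
      (t≤s+alpha*t⇒t≤4[1⊔1/′δ]*s 0<δ (0≤dist (inj₁ j) (inj₂ (π j ⟨$⟩ʳ k j)))
        (radius≤d+α*radius j))

  module _ (c : Fin n → ℚ) (r : Fin m → ℚ) (ℓ : Fin n → ℚ)
      (0≤r : ∀ j → 0ℚ ≤ r j) (0≤ℓ : ∀ f → 0ℚ ≤ ℓ f)
      (ℓ-feasible : ∀ f → c f * y f - Σℚ (λ j → x j f * r j) ≤ ℓ f) where

    revenue revenue′ : Fin n → ℚ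
    revenue  f = Σℚ (λ j → r j * x j f)
    revenue′ f = Σℚ (λ j → r j * xbar j f)

    ℓbar+revenue′≤[ℓ+revenue]/α : ∀ f →
      ℓbar c r f + revenue′ f ≤ (1ℚ /′ α) * (ℓ f + revenue f)
    ℓbar+revenue′≤[ℓ+revenue]/α f = 0⊔[p-q]+q≤r revenue′≤ cost≤
      where
      open ≤-Reasoning
      1/α X : ℚ
      1/α = 1ℚ /′ α
      X = revenue f
      cy≤ℓ+X : c f * y f ≤ ℓ f + X
      cy≤ℓ+X = begin
        c f * y f                               ≡⟨ p-q+q≡p (c f * y f) X ⟨
        c f * y f - X + X
          ≡⟨ cong (λ t → c f * y f - t + X) (Σℚ-cong (λ j → *-comm (r j) (x j f))) ⟩
        c f * y f - Σℚ (λ j → x j f * r j) + X  ≤⟨ +-monoˡ-≤ X (ℓ-feasible f) ⟩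
        ℓ f + X                                 ∎
      revenue′≤ : revenue′ f ≤ 1/α * (ℓ f + X)
      revenue′≤ = begin
        revenue′ f
          ≤⟨ Σℚ-mono-≤ (λ j → *-monoˡ-≤-nonNeg (r j) {{nonNegative (0≤r j)}} (xbar≤x*1/′α j f)) ⟩
        Σℚ (λ j → r j * (x j f * 1/α))  ≡⟨ Σℚ-cong (λ j → x∙yz≈z∙xy (r j) (x j f) 1/α) ⟩
        Σℚ (λ j → 1/α * (r j * x j f))  ≡⟨ *-distribˡ-Σℚ 1/α (λ j → r j * x j f) ⟨
        1/α * X                         ≤⟨ *-monoˡ-≤-nonNeg 1/α {{nonNegative 0≤1/′α}}
                                             (subst (_≤ ℓ f + X) (+-identityˡ X) (+-monoˡ-≤ X (0≤ℓ f))) ⟩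
        1/α * (ℓ f + X)                 ∎
      cost≤ : c f * ybar f ≤ 1/α * (ℓ f + X)
      cost≤ = begin
        c f * ybar f       ≡⟨ cong (c f *_) (p/′q≡p*1/′q (y f) α) ⟩
        c f * (y f * 1/α)  ≡⟨ x∙yz≈z∙xy (c f) (y f) 1/α ⟩
        1/α * (c f * y f)  ≤⟨ *-monoˡ-≤-nonNeg 1/α {{nonNegative 0≤1/′α}} cy≤ℓ+X ⟩
        1/α * (ℓ f + X)    ∎

    loss-bound : Σℚ ℓ ≤ δ * Σℚ r → Σℚ (ℓbar c r) ≤ 2ℚ * δ * Σℚ r
    loss-bound Σℓ≤δΣr = +-cancelʳ-≤ (Σℚ r) (begin
      Σℚ (ℓbar c r) + Σℚ r
        ≡⟨ cong (Σℚ (ℓbar c r) +_) (Σℚ-Σℚ-weighted-rows r xbar Σxbar≡1) ⟨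
      Σℚ (ℓbar c r) + Σℚ revenue′          ≡⟨ Σℚ-distrib-+ (ℓbar c r) revenue′ ⟨
      Σℚ (λ f → ℓbar c r f + revenue′ f)   ≤⟨ Σℚ-mono-≤ ℓbar+revenue′≤[ℓ+revenue]/α ⟩
      Σℚ (λ f → 1/α * (ℓ f + revenue f))   ≡⟨ *-distribˡ-Σℚ 1/α (λ f → ℓ f + revenue f) ⟨
      1/α * Σℚ (λ f → ℓ f + revenue f)     ≡⟨ cong (1/α *_) (Σℚ-distrib-+ ℓ revenue) ⟩
      1/α * (Σℚ ℓ + Σℚ revenue)
        ≡⟨ cong (λ t → 1/α * (Σℚ ℓ + t)) (Σℚ-Σℚ-weighted-rows r x Σx≡1) ⟩
      1/α * (Σℚ ℓ + Σℚ r)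
        ≤⟨ *-monoˡ-≤-nonNeg 1/α {{nonNegative 0≤1/′α}} (+-monoˡ-≤ (Σℚ r) Σℓ≤δΣr) ⟩
      1/α * (δ * Σℚ r + Σℚ r)              ≡⟨ factor 1/α δ (Σℚ r) ⟩
      1/α * (δ + 1ℚ) * Σℚ r
        ≤⟨ *-monoʳ-≤-nonNeg (Σℚ r) {{nonNegative (Σℚ-nonNeg 0≤r)}} (1/′alpha*[δ+1]≤2δ+1 0≤δ) ⟩
      (2ℚ * δ + 1ℚ) * Σℚ r                 ≡⟨ expand δ (Σℚ r) ⟩
      2ℚ * δ * Σℚ r + Σℚ r                 ∎)
      where
      open ≤-Reasoning
      open +-*-Solver
      1/α : ℚ
      1/α = 1ℚ /′ α
      factor : ∀ a δ s → a * (δ * s + s) ≡ a * (δ + 1ℚ) * s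
      factor = solve 3 (λ a δ s → a :* (δ :* s :+ s) := a :* (δ :+ con 1ℚ) :* s) refl
      expand : ∀ δ s → (2ℚ * δ + 1ℚ) * s ≡ 2ℚ * δ * s + s
      expand = solve 2 (λ δ s → (con 2ℚ :* δ :+ con 1ℚ) :* s := con 2ℚ :* δ :* s :+ s) refl

lemma1 : (m n : ℕ)
    (dist : Point m n → Point m n → ℚ) → IsMetric dist →
    (c : Fin n → ℚ) → (∀ f → 0ℚ ≤ c f) →
    (r : Fin m → ℚ) → (∀ j → 0ℚ ≤ r j) →
    (δ : ℚ) → 0ℚ < δ →
    (x : Fin m → Fin n → ℚ) (y : Fin n → ℚ) (ℓ : Fin n → ℚ) →
    (∀ j → Σℚ (λ f → x j f) ≡ 1ℚ) →
    (∀ j f → 0ℚ ≤ x j f) →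
    (∀ j f → x j f ≤ y f) →
    (∀ f → y f ≤ 1ℚ) →
    (∀ f → c f * y f - Σℚ (λ j → x j f * r j) ≤ ℓ f) →
    (∀ f → 0ℚ ≤ ℓ f) →
    Σℚ ℓ ≤ δ * Σℚ r →
    (π : Fin m → Permutation′ n) → PointRounding.Sorted dist x y δ π →
    (k : Fin m → Fin n) → PointRounding.IsFirstReach dist x y δ π k →
    ((∀ j f → 0ℚ < PointRounding.Output.xbar dist x y δ π k j f →
        dist (inj₁ j) (inj₂ f)
          ≤ 4ℚ * (1ℚ ⊔ (1ℚ /′ δ)) * Σℚ (λ f′ → x j f′ * dist (inj₁ j) (inj₂ f′)))
     × (Σℚ (PointRounding.Output.ℓbar dist x y δ π k c r) ≤ 2ℚ * δ * Σℚ r))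
lemma1 m n dist metric c _ r 0≤r δ 0<δ x y ℓ Σx≡1 0≤x _ _ ℓ-feasible 0≤ℓ Σℓ≤δΣr
       π sorted k first-reach =
  service-distance-bound (IsMetric.nonneg metric) sorted 0<δ ,
  loss-bound c r ℓ 0≤r 0≤ℓ ℓ-feasible Σℓ≤δΣr
  where open FirstReachRounding dist x y π k (<⇒≤ 0<δ) 0≤x Σx≡1 first-reach
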